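{- Let $\mathcal{I}$ be a finite set of closed intervals of the real line whose endpoints are pairwise distinct. Let $G$ be the overlap graph on $\mathcal{I}$, and let $G'$ be the graph on $\mathcal{I}$ obtained by joining each interval to its immediate left neighbor and to its immediate right neighbor (whenever these exist). Then $G'$ is a spanning subgraph of $G$ and has exactly the same connected components as $G$.
   Context: Two intervals $[a,b]$ and $[a',b']$ overlap if $a<a'<b<b'$ or $a'<a<b'<b$; the overlap graph has the intervals as vertices and an edge between every two overlapping intervals. For $I=[a,b]\in\mathcal{I}$ let $L(I)=\{[a',b']\in\mathcal{I}: a'<a<b'<b\}$ and $R(I)=\{[a',b']\in\mathcal{I}: a<a'<b<b'\}$. If $L(I)\neq\emptyset$, the immediate left neighbor of $I$ is the interval in $L(I)$ with the rightmost right endpoint; if $R(I)\ne\emptyset$, the immediate right neighbor of $I$ is the interval in $R(I)$ with the leftmost left endpoint.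
   Formalization: The endpoints of the intervals are rational numbers rather than arbitrary points of the real line. -}

module Defs where

open import Data.Nat using (ℕ)
open import Data.Fin using (Fin)
open import Data.Rational using (ℚ; _<_; _≤_)
open import Data.Product using (_×_; _,_; proj₁; proj₂)
open import Data.Sum using (_⊎_)
open import Relation.Binary.PropositionalEquality using (_≡_)
open import Relation.Nullary using (¬_)
open import Relation.Binary.Construct.Closure.ReflexiveTransitive using (Star)

record Intervals (n : ℕ) : Set where
  field
    left  : Fin n → ℚ
    right : Fin n → ℚ

open Intervals public

data Side : Set where
  L R : Side

endpoint : ∀ {n} → Intervals n → Fin n × Side → ℚ
endpoint I (i , L) = left I i
endpoint I (i , R) = right I i

WellFormed : ∀ {n} → Intervals n → Set
WellFormed {n} I =
  (∀ i → left I i < right I i) ×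
  (∀ p q → endpoint I p ≡ endpoint I q → p ≡ q)

InL : ∀ {n} → Intervals n → Fin n → Fin n → Set
InL I i j = (left I j < left I i) × (left I i < right I j) × (right I j < right I i)

InR : ∀ {n} → Intervals n → Fin n → Fin n → Set
InR I i j = (left I i < left I j) × (left I j < right I i) × (right I i < right I j)

Overlap : ∀ {n} → Intervals n → Fin n → Fin n → Set
Overlap I i j = InR I i j ⊎ InL I i j

ImmLeft : ∀ {n} → Intervals n → Fin n → Fin n → Set
ImmLeft I i j = InL I i j × (∀ k → InL I i k → right I k ≤ right I j)

ImmRight : ∀ {n} → Intervals n → Fin n → Fin n → Set
ImmRight I i j = InR I i j × (∀ k → InR I i k → left I j ≤ left I k)

-- Edges of G': each interval joined to its immediate left and right neighbours
-- (undirected, so either endpoint of the edge may be the one whose neighbour it is).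
Edge' : ∀ {n} → Intervals n → Fin n → Fin n → Set
Edge' I i j = ImmLeft I i j ⊎ ImmRight I i j ⊎ ImmLeft I j i ⊎ ImmRight I j i

Connected : ∀ {n} → (Fin n → Fin n → Set) → Fin n → Fin n → Set
Connected E = Star E

-- Take i = [a,b] overlapping j = [a',b'] with a < a' < b < b'. Either the immediate
-- right neighbour k of i is j, or it overlaps j, or (if k reaches past b') the
-- immediate left neighbour m of j is i, or overlaps i, or overlaps k. In each
-- remaining case the new overlapping pair meets in a strictly larger region than
-- [a',b], and that region contains an endpoint of an interval enclosing [a',b].
-- So the set of intervals with an endpoint in the meeting region strictly grows,
-- and induction on it produces a path of neighbour edges from i to j.
module Submission where

open import Defs
open import Data.Nat using (ℕ; zero; suc)
open import Data.Fin using (Fin; zero; suc)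
open import Data.Fin.Subset using (Subset; _∈_; _⊂_; _⊃_)
open import Data.Fin.Subset.Induction using (⊃-wellFounded)
open import Data.Vec using ([]; _∷_; here; there)
open import Data.Product using (_×_; _,_; ∃; proj₁)
open import Data.Sum using (_⊎_; inj₁; inj₂)
import Data.Sum as Sum
open import Data.Rational using (ℚ; _<_; _≤_)
open import Data.Rational.Properties
  using (_<?_; _≤?_; <-cmp; <⇒≢; ≤-isTotalPreorder; ≤-refl; ≤-trans; <-trans; <⇒≤; <-≤-trans; <-irrefl)
open import Function using (_∘_)
open import Induction.WellFounded using (Acc; acc)
open import Level using (Level)
open import Relation.Binary using (Rel; IsTotalPreorder; tri<; tri≈; tri>)
import Relation.Binary.Construct.Flip.EqAndOrd as Flip
open import Relation.Binary.Construct.Closure.ReflexiveTransitive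
  using (Star; _◅_; _◅◅_; return; reverse; map; _⋆)
open import Relation.Binary.PropositionalEquality using (_≡_; refl; cong; subst; sym)
open import Relation.Nullary using (¬_; Dec; does; yes; no; contradiction)
open import Relation.Nullary.Decidable using (_×-dec_; _⊎-dec_)
open import Relation.Unary using (Pred; Decidable; _⊆_)

private
  variable
    a ℓ p q : Level
    n : ℕ

module _ {A : Set a} {_≼_ : Rel A ℓ} (≼-isTotalPreorder : IsTotalPreorder _≡_ _≼_) where
  open IsTotalPreorder ≼-isTotalPreorder using (total; trans) renaming (refl to ≼-refl)

  least : {P : Pred (Fin n) p} → Decidable P → (f : Fin n → A) →
          (∃ λ k → P k × ∀ l → P l → f k ≼ f l) ⊎ (∀ l → ¬ P l)
  least {zero} P? f = inj₂ λ ()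
  least {suc n} P? f with least (P? ∘ suc) (f ∘ suc) | P? zero
  ... | inj₂ none | yes p₀ = inj₁ (zero , p₀ , λ { zero _ → ≼-refl ; (suc l) pl → contradiction pl (none l) })
  ... | inj₂ none | no ¬p₀ = inj₂ λ { zero → ¬p₀ ; (suc l) → none l }
  ... | inj₁ (k , pk , k-least) | no ¬p₀ = inj₁ (suc k , pk , λ { zero p₀ → contradiction p₀ ¬p₀ ; (suc l) → k-least l })
  ... | inj₁ (k , pk , k-least) | yes p₀ with total (f zero) (f (suc k))
  ...   | inj₁ f₀≼fk = inj₁ (zero , p₀ , λ { zero _ → ≼-refl ; (suc l) pl → trans f₀≼fk (k-least l pl) })
  ...   | inj₂ fk≼f₀ = inj₁ (suc k , pk , λ { zero _ → fk≼f₀ ; (suc l) → k-least l })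

satisfying : {P : Pred (Fin n) p} → Decidable P → Subset n
satisfying {zero} P? = []
satisfying {suc n} P? = does (P? zero) ∷ satisfying (P? ∘ suc)

∈-satisfying⁺ : {P : Pred (Fin n) p} (P? : Decidable P) → ∀ {x} → P x → x ∈ satisfying P?
∈-satisfying⁺ P? {zero} px with P? zero
... | yes _ = here
... | no ¬px = contradiction px ¬px
∈-satisfying⁺ P? {suc x} px = there (∈-satisfying⁺ (P? ∘ suc) px)

∈-satisfying⁻ : {P : Pred (Fin n) p} (P? : Decidable P) → ∀ {x} → x ∈ satisfying P? → P x
∈-satisfying⁻ P? {zero} x∈ with P? zero | x∈
... | yes px | _ = px
∈-satisfying⁻ P? {suc x} (there x∈) = ∈-satisfying⁻ (P? ∘ suc) x∈

satisfying-⊂ : {P : Pred (Fin n) p} {Q : Pred (Fin n) q} (P? : Decidable P) (Q? : Decidable Q) →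
               P ⊆ Q → ∀ {t} → Q t → ¬ P t → satisfying P? ⊂ satisfying Q?
satisfying-⊂ P? Q? P⊆Q {t} qt ¬pt =
  ∈-satisfying⁺ Q? ∘ P⊆Q ∘ ∈-satisfying⁻ P? , t , ∈-satisfying⁺ Q? qt , ¬pt ∘ ∈-satisfying⁻ P?

<⇒≱ : ∀ {x y : ℚ} → x < y → ¬ y ≤ x
<⇒≱ x<y y≤x = <-irrefl refl (<-≤-trans x<y y≤x)

module _ {n : ℕ} (I : Intervals n) where

  Edge'-sym : ∀ {i j} → Edge' I i j → Edge' I j i
  Edge'-sym (inj₁ e)                 = inj₂ (inj₂ (inj₁ e))
  Edge'-sym (inj₂ (inj₁ e))          = inj₂ (inj₂ (inj₂ e))
  Edge'-sym (inj₂ (inj₂ (inj₁ e)))   = inj₁ e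
  Edge'-sym (inj₂ (inj₂ (inj₂ e)))   = inj₂ (inj₁ e)

  Edge'⇒Overlap : ∀ {i j} → Edge' I i j → Overlap I i j
  Edge'⇒Overlap (inj₁ (l , _))               = inj₂ l
  Edge'⇒Overlap (inj₂ (inj₁ (r , _)))        = inj₁ r
  Edge'⇒Overlap (inj₂ (inj₂ (inj₁ (l , _)))) = inj₁ l
  Edge'⇒Overlap (inj₂ (inj₂ (inj₂ (r , _)))) = inj₂ r

  inR? : ∀ i → Decidable (InR I i)
  inR? i t = (left I i <? left I t) ×-dec (left I t <? right I i) ×-dec (right I i <? right I t)

  inL? : ∀ i → Decidable (InL I i)
  inL? i t = (left I t <? left I i) ×-dec (left I i <? right I t) ×-dec (right I t <? right I i)

  immediateRight : ∀ {i j} → InR I i j → ∃ (ImmRight I i)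
  immediateRight {i} {j} r with least ≤-isTotalPreorder (inR? i) (left I)
  ... | inj₁ k = k
  ... | inj₂ none = contradiction r (none j)

  immediateLeft : ∀ {i j} → InL I i j → ∃ (ImmLeft I i)
  immediateLeft {i} {j} l with least (Flip.isTotalPreorder ≤-isTotalPreorder) (inL? i) (right I)
  ... | inj₁ k = k
  ... | inj₂ none = contradiction l (none j)

  Within : ℚ → ℚ → ℚ → Set
  Within x y e = x ≤ e × e ≤ y

  Touches : ℚ → ℚ → Fin n → Set
  Touches x y t = Within x y (left I t) ⊎ Within x y (right I t)

  touches? : ∀ x y → Decidable (Touches x y)
  touches? x y t = within? (left I t) ⊎-dec within? (right I t)
    where
    within? : ∀ e → Dec (Within x y e)
    within? e = (x ≤? e) ×-dec (e ≤? y)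

  meeting : Fin n → Fin n → Subset n
  meeting i j = satisfying (touches? (left I j) (right I i))

  meeting-⊂ : ∀ {i j i' j' t} → left I j' ≤ left I j → right I i ≤ right I i' →
              left I t < left I j → right I i < right I t →
              Touches (left I j') (right I i') t → meeting i j ⊂ meeting i' j'
  meeting-⊂ {i} {j} {i'} {j'} {t} j'≤j i≤i' t<j i<t touch =
    satisfying-⊂ (touches? _ _) (touches? _ _) (Sum.map widen widen) touch untouched
    where
    widen : ∀ {e} → Within (left I j) (right I i) e → Within (left I j') (right I i') e
    widen (j≤e , e≤i) = ≤-trans j'≤j j≤e , ≤-trans e≤i i≤i'
    untouched : ¬ Touches (left I j) (right I i) t
    untouched (inj₁ (j≤t , _)) = <⇒≱ t<j j≤t
    untouched (inj₂ (_ , t≤i)) = <⇒≱ i<t t≤i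

  immRight⇒Edge' : ∀ {i j} → ImmRight I i j → Edge' I i j
  immRight⇒Edge' = inj₂ ∘ inj₁

  immLeft⇒Edge' : ∀ {i j} → ImmLeft I j i → Edge' I i j
  immLeft⇒Edge' = inj₂ ∘ inj₂ ∘ inj₁

module _ {n : ℕ} (I : Intervals n)
         (left-injective : ∀ {i j} → left I i ≡ left I j → i ≡ j)
         (right-injective : ∀ {i j} → right I i ≡ right I j → i ≡ j) where

  InR⇒Connected : ∀ {i j} → InR I i j → Connected (Edge' I) i j
  InR⇒Connected = bridge (⊃-wellFounded _)
    where
    bridge : ∀ {i j} → Acc _⊃_ (meeting I i j) → InR I i j → Star (Edge' I) i j
    bridge {i} {j} (acc larger) r@(a<a' , a'<b , b<b') with immediateRight I r
    ... | k , k-imm@((a<c , _ , b<d) , k-least) with <-cmp (left I k) (left I j)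
    ...   | tri> _ _ a'<c = contradiction (k-least j r) (<⇒≱ a'<c)
    ...   | tri≈ _ c≡a' _ = subst (Star (Edge' I) i) (left-injective c≡a') (return (immRight⇒Edge' I k-imm))
    ...   | tri< c<a' _ _ with <-cmp (right I k) (right I j)
    ...     | tri≈ _ d≡b' _ = contradiction (cong (left I) (right-injective d≡b')) (<⇒≢ c<a')
    ...     | tri< d<b' _ _ = immRight⇒Edge' I k-imm ◅ bridge (larger grows) (c<a' , a'<d , d<b')
      where
      a'<d : left I j < right I k
      a'<d = <-trans a'<b b<d
      grows : meeting I i j ⊂ meeting I k j
      grows = meeting-⊂ I ≤-refl (<⇒≤ b<d) c<a' b<d (inj₂ (<⇒≤ a'<d , ≤-refl))
    ...     | tri> _ _ b'<d with immediateLeft I {j} {i} r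
    ...       | m , m-imm@((e<a' , a'<f , f<b') , m-greatest) with <-cmp (right I i) (right I m)
    ...         | tri> _ _ f<b = contradiction (m-greatest i r) (<⇒≱ f<b)
    ...         | tri≈ _ b≡f _ =
      subst (λ x → Star (Edge' I) x j) (sym (right-injective b≡f)) (return (immLeft⇒Edge' I m-imm))
    ...         | tri< b<f _ _ with <-cmp (left I i) (left I m)
    ...           | tri≈ _ a≡e _ = contradiction (cong (right I) (left-injective a≡e)) (<⇒≢ b<f)
    ...           | tri< a<e _ _ = bridge (larger grows) (a<e , e<b , b<f) ◅◅ return (immLeft⇒Edge' I m-imm)
      where
      e<b : left I m < right I i
      e<b = <-trans e<a' a'<b
      grows : meeting I i j ⊂ meeting I i m
      grows = meeting-⊂ I (<⇒≤ e<a') ≤-refl e<a' b<f (inj₁ (≤-refl , <⇒≤ e<b))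
    ...           | tri> _ _ e<a =
      immRight⇒Edge' I k-imm ◅ reverse (Edge'-sym I) (bridge (larger grows) m-k) ◅◅ return (immLeft⇒Edge' I m-imm)
      where
      c<f : left I k < right I m
      c<f = <-trans c<a' a'<f
      m-k : InR I m k
      m-k = <-trans e<a a<c , c<f , <-trans f<b' b'<d
      grows : meeting I i j ⊂ meeting I m k
      grows = meeting-⊂ I (<⇒≤ c<a') (<⇒≤ b<f) c<a' b<d (inj₁ (≤-refl , <⇒≤ c<f))

  Overlap⇒Connected : ∀ {i j} → Overlap I i j → Connected (Edge' I) i j
  Overlap⇒Connected (inj₁ r) = InR⇒Connected r
  Overlap⇒Connected (inj₂ l) = reverse (Edge'-sym I) (InR⇒Connected l)

lemma19 : (n : ℕ) (I : Intervals n) → WellFormed I →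
    (∀ i j → Edge' I i j → Overlap I i j) ×
    (∀ i j → (Connected (Overlap I) i j → Connected (Edge' I) i j) ×
             (Connected (Edge' I) i j → Connected (Overlap I) i j))
lemma19 n I (_ , distinct) =
  (λ _ _ → Edge'⇒Overlap I) ,
  (λ _ _ → Overlap⇒Connected I left-injective right-injective ⋆ , map (Edge'⇒Overlap I))
  where
  left-injective : ∀ {i j} → left I i ≡ left I j → i ≡ j
  left-injective eq = cong proj₁ (distinct (_ , L) (_ , L) eq)
  right-injective : ∀ {i j} → right I i ≡ right I j → i ≡ j
  right-injective eq = cong proj₁ (distinct (_ , R) (_ , R) eq)
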